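{- Let $2\leq m\leq n$. If $u$ and $v$ are incomparable elements of $(P_n\times P_2^m,\trianglelefteq)$, then the distance between $u$ and $v$ in the Hasse diagram of $(P_n\times P_2^m,\trianglelefteq)$ is at most $1+\binom{m}{2}$.
   Context: $P_k=\{0,\dots,k-1\}$, and $P_n\times P_2^m$ is the set of integer tuples $(v_0,\dots,v_m)$ with $0\leq v_0\leq n-1$ and $v_1,\dots,v_m\in\{0,1\}$. The dominance order on $\mathbb{Z}^{m+1}$: $(a_0,\dots,a_m)\trianglelefteq(b_0,\dots,b_m)$ iff $\sum_{j=0}^{i}a_j\leq\sum_{j=0}^{i}b_j$ for all $0\leq i\leq m$; $P_n\times P_2^m$ carries the induced order. The Hasse diagram is the undirected graph whose edges are the covering pairs of the order. -}

module Defs where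

open import Data.Nat using (ℕ; zero; suc; _+_; _≤_; _<_)
open import Data.Fin using (Fin; toℕ)
open import Data.Vec using (Vec; []; _∷_)
open import Data.Product using (_×_; Σ; ∃; _,_)
open import Data.Sum using (_⊎_)
open import Relation.Binary.PropositionalEquality using (_≡_)
open import Relation.Nullary using (¬_)

record Elem (n m : ℕ) : Set where
  constructor ⟨_,_⟩
  field
    head : Fin n
    bits : Vec (Fin 2) m
open Elem public

PrefLe : ∀ {m} → ℕ → ℕ → Vec (Fin 2) m → Vec (Fin 2) m → Set
PrefLe a b [] [] = a ≤ b
PrefLe a b (x ∷ xs) (y ∷ ys) = a ≤ b × PrefLe (a + toℕ x) (b + toℕ y) xs ys

-- Dominance order: u ⊴ v iff all partial sums of u are ≤ those of v.
_⊴_ : ∀ {n m} → Elem n m → Elem n m → Set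
u ⊴ v = PrefLe (toℕ (head u)) (toℕ (head v)) (bits u) (bits v)

_◁_ : ∀ {n m} → Elem n m → Elem n m → Set
u ◁ v = u ⊴ v × ¬ (u ≡ v)

_⋖_ : ∀ {n m} → Elem n m → Elem n m → Set
u ⋖ v = u ◁ v × (∀ w → ¬ (u ◁ w × w ◁ v))

Incomparable : ∀ {n m} → Elem n m → Elem n m → Set
Incomparable u v = ¬ (u ⊴ v) × ¬ (v ⊴ u)

HasseEdge : ∀ {n m} → Elem n m → Elem n m → Set
HasseEdge u v = u ⋖ v ⊎ v ⋖ u

data Walk {n m : ℕ} : Elem n m → Elem n m → ℕ → Set where
  here : ∀ {u} → Walk u u zero
  step : ∀ {u v w k} → HasseEdge u v → Walk v w k → Walk u w (suc k)

DistLe : ∀ {n m} → Elem n m → Elem n m → ℕ → Set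
DistLe u v d = ∃ λ k → k ≤ d × Walk u v k

-- Measure two elements by the ℓ¹ distance between their vectors of prefix sums.
-- If u ⊴ v and u ≠ v, some element w with u ⊴ w ⊴ v is at distance 1 from u;
-- as this distance is additive along ⊴-chains, such a w covers u, so comparable
-- elements are joined by a monotone walk whose length is their distance. The
-- pointwise minimum of the prefix sums of u and v is an element below both that
-- lies on an ℓ¹-geodesic from u to v, so the Hasse distance is at most the ℓ¹
-- distance. When u and v are incomparable the difference of their prefix sums,
-- which changes by at most 1 per coordinate, takes both signs; this bounds the
-- ℓ¹ distance by 1 + C(m,2).
module Submission where

open import Defs
open import Data.Nat using (ℕ; zero; suc; _+_; _*_; _≤_; _<_; _⊓_; z≤n; s≤s; s≤s⁻¹; ∣_-_∣; _≟_; _≤?_)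
open import Data.Nat.Properties
open import Data.Nat.Combinatorics using (_C_; nCk+nC[k+1]≡[n+1]C[k+1]; nC1≡n)
open import Data.Nat.Tactic.RingSolver using (solve-∀)
open import Algebra.Properties.CommutativeSemigroup +-commutativeSemigroup using (interchange)
open import Data.Fin using (Fin; toℕ; fromℕ<)
open import Data.Fin.Patterns using (0F; 1F)
open import Data.Fin.Properties using (toℕ-injective; toℕ-fromℕ<; toℕ<n; toℕ≤pred[n])
open import Data.Vec using (Vec; []; _∷_)
open import Data.Product using (∃; _×_; _,_; proj₁; proj₂)
open import Data.Sum using (inj₁; inj₂)
open import Data.Empty using (⊥-elim)
open import Function using (_∘_)
open import Relation.Nullary using (¬_; yes; no)
open import Relation.Binary.Definitions using (tri<; tri≈; tri>)
open import Relation.Binary.PropositionalEquality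

∣n-1+n∣≡1 : ∀ n → ∣ n - suc n ∣ ≡ 1
∣n-1+n∣≡1 zero    = refl
∣n-1+n∣≡1 (suc n) = ∣n-1+n∣≡1 n

m≤n≤o⇒∣m-o∣≡∣m-n∣+∣n-o∣ : ∀ {a b c} → a ≤ b → b ≤ c → ∣ a - c ∣ ≡ ∣ a - b ∣ + ∣ b - c ∣
m≤n≤o⇒∣m-o∣≡∣m-n∣+∣n-o∣ {zero}  {b} {c} z≤n b≤c = sym (trans (cong (b +_) (m≤n⇒∣m-n∣≡n∸m b≤c)) (m+[n∸m]≡n b≤c))
m≤n≤o⇒∣m-o∣≡∣m-n∣+∣n-o∣ {suc a} {suc b} {suc c} (s≤s a≤b) (s≤s b≤c) = m≤n≤o⇒∣m-o∣≡∣m-n∣+∣n-o∣ a≤b b≤c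

m≤n≤m+o⇒∣m-n∣≤o : ∀ {m n o} → m ≤ n → n ≤ m + o → ∣ m - n ∣ ≤ o
m≤n≤m+o⇒∣m-n∣≤o {m} {n} m≤n n≤m+o =
  subst (_≤ _) (sym (m≤n⇒∣m-n∣≡n∸m m≤n)) (m≤n+o⇒m∸n≤o n m n≤m+o)

∣m⊓n-m∣+∣m⊓n-n∣≡∣m-n∣ : ∀ m n → ∣ m ⊓ n - m ∣ + ∣ m ⊓ n - n ∣ ≡ ∣ m - n ∣
∣m⊓n-m∣+∣m⊓n-n∣≡∣m-n∣ m n with ≤-total m n
... | inj₁ m≤n rewrite m≤n⇒m⊓n≡m m≤n | ∣n-n∣≡0 m = refl
... | inj₂ n≤m rewrite m≥n⇒m⊓n≡n n≤m | ∣n-n∣≡0 n = trans (+-identityʳ _) (∣-∣-comm n m)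

[1+n]C2≡n+nC2 : ∀ n → suc n C 2 ≡ n + n C 2
[1+n]C2≡n+nC2 n = trans (sym (nCk+nC[k+1]≡[n+1]C[k+1] n 1)) (cong (_+ n C 2) (nC1≡n n))

toℕ≤1 : (x : Fin 2) → toℕ x ≤ 1
toℕ≤1 = toℕ≤pred[n]

∣bit-bit∣≤1 : (x y : Fin 2) → ∣ toℕ x - toℕ y ∣ ≤ 1
∣bit-bit∣≤1 0F 0F = z≤n
∣bit-bit∣≤1 0F 1F = ≤-refl
∣bit-bit∣≤1 1F 0F = ≤-refl
∣bit-bit∣≤1 1F 1F = z≤n

∣m+o-n+p∣≤∣m-n∣+∣o-p∣ : ∀ m n o p → ∣ m + o - n + p ∣ ≤ ∣ m - n ∣ + ∣ o - p ∣
∣m+o-n+p∣≤∣m-n∣+∣o-p∣ m n o p = begin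
  ∣ m + o - n + p ∣                    ≤⟨ ∣-∣-triangle (m + o) (n + o) (n + p) ⟩
  ∣ m + o - n + o ∣ + ∣ n + o - n + p ∣  ≡⟨ cong (_+ ∣ n + o - n + p ∣) (cong₂ ∣_-_∣ (+-comm m o) (+-comm n o)) ⟩
  ∣ o + m - o + n ∣ + ∣ n + o - n + p ∣  ≡⟨ cong₂ _+_ (∣m+n-m+o∣≡∣n-o∣ o m n) (∣m+n-m+o∣≡∣n-o∣ n o p) ⟩
  ∣ m - n ∣ + ∣ o - p ∣                ∎
  where open ≤-Reasoning

prefDist : ∀ {m} → ℕ → ℕ → Vec (Fin 2) m → Vec (Fin 2) m → ℕ
prefDist a b []       []       = ∣ a - b ∣
prefDist a b (x ∷ xs) (y ∷ ys) = ∣ a - b ∣ + prefDist (a + toℕ x) (b + toℕ y) xs ys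

dist : ∀ {n m} → Elem n m → Elem n m → ℕ
dist u v = prefDist (toℕ (head u)) (toℕ (head v)) (bits u) (bits v)

PrefLe⇒≤ : ∀ {m a b} (xs ys : Vec (Fin 2) m) → PrefLe a b xs ys → a ≤ b
PrefLe⇒≤ []       []       a≤b       = a≤b
PrefLe⇒≤ (x ∷ xs) (y ∷ ys) (a≤b , _) = a≤b

PrefLe-reflexive : ∀ {m a b} (xs : Vec (Fin 2) m) → a ≡ b → PrefLe a b xs xs
PrefLe-reflexive []       a≡b = ≤-reflexive a≡b
PrefLe-reflexive (x ∷ xs) a≡b = ≤-reflexive a≡b , PrefLe-reflexive xs (cong (_+ toℕ x) a≡b)

PrefLe-respˡ : ∀ {m a a′ b} {xs ys : Vec (Fin 2) m} → a ≡ a′ → PrefLe a b xs ys → PrefLe a′ b xs ys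
PrefLe-respˡ refl p = p

PrefLe-respʳ : ∀ {m a b b′} {xs ys : Vec (Fin 2) m} → b ≡ b′ → PrefLe a b xs ys → PrefLe a b′ xs ys
PrefLe-respʳ refl p = p

+length≤⇒PrefLe : ∀ {m a b} (xs ys : Vec (Fin 2) m) → a + m ≤ b → PrefLe a b xs ys
+length≤⇒PrefLe {a = a} []       []       a+0≤b = subst (_≤ _) (+-identityʳ a) a+0≤b
+length≤⇒PrefLe {suc m} {a} {b} (x ∷ xs) (y ∷ ys) a+1+m≤b =
  ≤-trans (m≤m+n a (suc m)) a+1+m≤b , +length≤⇒PrefLe xs ys (begin
    a + toℕ x + m   ≤⟨ +-monoˡ-≤ m (+-monoʳ-≤ a (toℕ≤1 x)) ⟩
    a + 1 + m       ≡⟨ +-assoc a 1 m ⟩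
    a + suc m       ≤⟨ a+1+m≤b ⟩
    b               ≤⟨ m≤m+n b (toℕ y) ⟩
    b + toℕ y       ∎)
  where open ≤-Reasoning

¬PrefLe⇒<+length : ∀ {m a b} (xs ys : Vec (Fin 2) m) → ¬ PrefLe a b xs ys → b < a + m
¬PrefLe⇒<+length xs ys ¬p = ≰⇒> (¬p ∘ +length≤⇒PrefLe xs ys)

prefDist-reflexive : ∀ {m a b} (xs : Vec (Fin 2) m) → a ≡ b → prefDist a b xs xs ≡ 0
prefDist-reflexive []       a≡b = m≡n⇒∣m-n∣≡0 a≡b
prefDist-reflexive (x ∷ xs) a≡b =
  cong₂ _+_ (m≡n⇒∣m-n∣≡0 a≡b) (prefDist-reflexive xs (cong (_+ toℕ x) a≡b))

prefDist-sym : ∀ {m} a b (xs ys : Vec (Fin 2) m) → prefDist a b xs ys ≡ prefDist b a ys xs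
prefDist-sym a b []       []       = ∣-∣-comm a b
prefDist-sym a b (x ∷ xs) (y ∷ ys) = cong₂ _+_ (∣-∣-comm a b) (prefDist-sym _ _ xs ys)

prefDist≡0⇒≡ : ∀ {m a b} (xs ys : Vec (Fin 2) m) → prefDist a b xs ys ≡ 0 → a ≡ b × xs ≡ ys
prefDist≡0⇒≡ []       []       d≡0 = ∣m-n∣≡0⇒m≡n d≡0 , refl
prefDist≡0⇒≡ {a = a} {b} (x ∷ xs) (y ∷ ys) d≡0 =
  a≡b , cong₂ _∷_ (toℕ-injective (+-cancelˡ-≡ a _ _ a+x≡a+y)) (proj₂ tails)
  where
  a≡b : a ≡ b
  a≡b = ∣m-n∣≡0⇒m≡n (m+n≡0⇒m≡0 ∣ a - b ∣ d≡0)
  tails : a + toℕ x ≡ b + toℕ y × xs ≡ ys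
  tails = prefDist≡0⇒≡ xs ys (m+n≡0⇒n≡0 ∣ a - b ∣ d≡0)
  a+x≡a+y : a + toℕ x ≡ a + toℕ y
  a+x≡a+y = trans (proj₁ tails) (cong (_+ toℕ y) (sym a≡b))

prefDist-additive : ∀ {m a b c} (xs ys zs : Vec (Fin 2) m) → PrefLe a b xs ys → PrefLe b c ys zs →
                    prefDist a c xs zs ≡ prefDist a b xs ys + prefDist b c ys zs
prefDist-additive []       []       []       a≤b b≤c = m≤n≤o⇒∣m-o∣≡∣m-n∣+∣n-o∣ a≤b b≤c
prefDist-additive {a = a} {b} {c} (x ∷ xs) (y ∷ ys) (z ∷ zs) (a≤b , p) (b≤c , q) =
  trans (cong₂ _+_ (m≤n≤o⇒∣m-o∣≡∣m-n∣+∣n-o∣ a≤b b≤c) (prefDist-additive xs ys zs p q))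
        (interchange ∣ a - b ∣ ∣ b - c ∣ _ _)

dist≡0⇒≡ : ∀ {n m} {u v : Elem n m} → dist u v ≡ 0 → u ≡ v
dist≡0⇒≡ {u = ⟨ g , xs ⟩} {⟨ h , ys ⟩} d≡0 with prefDist≡0⇒≡ xs ys d≡0
... | g≡h , refl = cong ⟨_, xs ⟩ (toℕ-injective g≡h)

dist≡1⇒⋖ : ∀ {n m} {u w : Elem n m} → u ⊴ w → dist u w ≡ 1 → u ⋖ w
dist≡1⇒⋖ {u = u} {w} u⊴w d≡1 = (u⊴w , u≢w) , nothingBetween
  where
  u≢w : ¬ u ≡ w
  u≢w refl = 0≢1+n (trans (sym (prefDist-reflexive (bits u) refl)) d≡1)
  nothingBetween : ∀ x → ¬ (u ◁ x × x ◁ w)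
  nothingBetween x ((u⊴x , u≢x) , (x⊴w , x≢w))
    with dist u x in eq | prefDist-additive (bits u) (bits x) (bits w) u⊴x x⊴w
  ... | zero  | _     = u≢x (dist≡0⇒≡ eq)
  ... | suc k | split = x≢w (dist≡0⇒≡ (m+n≡0⇒n≡0 k (suc-injective (trans (sym split) d≡1))))

data UnitStep {m} (a b : ℕ) (xs ys : Vec (Fin 2) m) : Set where
  keepHead  : (zs : Vec (Fin 2) m) → PrefLe a a xs zs → PrefLe a b zs ys →
              prefDist a a xs zs ≡ 1 → UnitStep a b xs ys
  raiseHead : (zs : Vec (Fin 2) m) → PrefLe a (suc a) xs zs → PrefLe (suc a) b zs ys →
              prefDist a (suc a) xs zs ≡ 1 → UnitStep a b xs ys

a+1≡1+a+0 : ∀ a → a + 1 ≡ suc a + 0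
a+1≡1+a+0 a = trans (+-comm a 1) (sym (+-identityʳ (suc a)))

unitStep-raiseFirst : ∀ {m a b} (y : Fin 2) (xs ys : Vec (Fin 2) m) → a < b →
                      PrefLe (a + 1) (b + toℕ y) xs ys → UnitStep a b (1F ∷ xs) (y ∷ ys)
unitStep-raiseFirst {a = a} y xs ys a<b p =
  raiseHead (0F ∷ xs)
    (n≤1+n a , PrefLe-reflexive xs (a+1≡1+a+0 a))
    (a<b , PrefLe-respˡ (a+1≡1+a+0 a) p)
    (cong₂ _+_ (∣n-1+n∣≡1 a) (prefDist-reflexive xs (a+1≡1+a+0 a)))

unitStep-∷ : ∀ {m} a b (x y : Fin 2) {xs ys : Vec (Fin 2) m} → a ≤ b →
             PrefLe (a + toℕ x) (b + toℕ y) xs ys → UnitStep (a + toℕ x) (b + toℕ y) xs ys →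
             UnitStep a b (x ∷ xs) (y ∷ ys)
unitStep-∷ a b x y {xs} a≤b _ (keepHead zs p q d≡1) =
  keepHead (x ∷ zs) (≤-refl , p) (a≤b , q) (trans (cong (_+ prefDist (a + toℕ x) (a + toℕ x) xs zs) (∣n-n∣≡0 a)) d≡1)
unitStep-∷ a b 0F y {xs} a≤b _ (raiseHead zs p q d≡1) =
  keepHead (1F ∷ zs) (≤-refl , PrefLe-respʳ 1+a+0≡a+1 p) (a≤b , PrefLe-respˡ 1+a+0≡a+1 q)
    (trans (cong₂ _+_ (∣n-n∣≡0 a) (cong (λ c → prefDist (a + 0) c xs zs) (sym 1+a+0≡a+1))) d≡1)
  where
  1+a+0≡a+1 : suc (a + 0) ≡ a + 1
  1+a+0≡a+1 = sym (+-suc a 0)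
unitStep-∷ a b 1F y {xs} {ys} _ p (raiseHead zs _ q _) = unitStep-raiseFirst y xs ys a<b p
  where
  a<b : a < b
  a<b = +-cancelʳ-≤ 1 (suc a) b (≤-trans (PrefLe⇒≤ zs ys q) (+-monoʳ-≤ b (toℕ≤1 y)))

unitStep-equalTails : ∀ {m a b} (x y : Fin 2) (xs : Vec (Fin 2) m) → a < b →
                      a + toℕ x ≡ b + toℕ y → UnitStep a b (x ∷ xs) (y ∷ xs)
unitStep-equalTails {a = a} {b} 0F y xs a<b a+0≡b+y =
  ⊥-elim (<⇒≱ a<b (≤-trans (m≤m+n b (toℕ y)) (≤-reflexive (trans (sym a+0≡b+y) (+-identityʳ a)))))
unitStep-equalTails 1F y xs a<b a+1≡b+y = unitStep-raiseFirst y xs xs a<b (PrefLe-reflexive xs a+1≡b+y)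

-- Raises the last prefix sum of (a, xs) that is below that of (b, ys) and can be raised alone.
unitStep : ∀ {m} a b (xs ys : Vec (Fin 2) m) → PrefLe a b xs ys → prefDist a b xs ys ≢ 0 →
           UnitStep a b xs ys
unitStep a b [] [] a≤b d≢0 = raiseHead [] (n≤1+n a) (≤∧≢⇒< a≤b (d≢0 ∘ m≡n⇒∣m-n∣≡0)) (∣n-1+n∣≡1 a)
unitStep a b (x ∷ xs) (y ∷ ys) (a≤b , p) d≢0 with prefDist (a + toℕ x) (b + toℕ y) xs ys ≟ 0
... | no tail≢0 = unitStep-∷ a b x y a≤b p (unitStep _ _ xs ys p tail≢0)
... | yes tail≡0 with prefDist≡0⇒≡ xs ys tail≡0
...   | a+x≡b+y , refl = unitStep-equalTails x y xs a<b a+x≡b+y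
  where
  a<b : a < b
  a<b = ≤∧≢⇒< a≤b (λ a≡b → d≢0 (cong₂ _+_ (m≡n⇒∣m-n∣≡0 a≡b) tail≡0))

∃-elem-between : ∀ {n m k} {u v : Elem n m} c (zs : Vec (Fin 2) m) →
                 PrefLe (toℕ (head u)) c (bits u) zs → PrefLe c (toℕ (head v)) zs (bits v) →
                 prefDist (toℕ (head u)) c (bits u) zs ≡ k → ∃ λ w → u ⊴ w × w ⊴ v × dist u w ≡ k
∃-elem-between {n} {m} {k} {u} {v} c zs p q d≡k = withHead (fromℕ< c<n) (toℕ-fromℕ< c<n)
  where
  c<n : c < n
  c<n = ≤-<-trans (PrefLe⇒≤ zs (bits v) q) (toℕ<n (head v))
  withHead : (f : Fin n) → toℕ f ≡ c → ∃ λ w → u ⊴ w × w ⊴ v × dist u w ≡ k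
  withHead f refl = ⟨ f , zs ⟩ , p , q , d≡k

∃-unitStep : ∀ {n m} {u v : Elem n m} → u ⊴ v → dist u v ≢ 0 →
             ∃ λ w → u ⊴ w × w ⊴ v × dist u w ≡ 1
∃-unitStep {u = u} {v} u⊴v d≢0 with unitStep _ _ (bits u) (bits v) u⊴v d≢0
... | keepHead  zs p q d≡1 = ∃-elem-between _ zs p q d≡1
... | raiseHead zs p q d≡1 = ∃-elem-between _ zs p q d≡1

HasseEdge-sym : ∀ {n m} {u v : Elem n m} → HasseEdge u v → HasseEdge v u
HasseEdge-sym (inj₁ u⋖v) = inj₂ u⋖v
HasseEdge-sym (inj₂ v⋖u) = inj₁ v⋖u

Walk-++ : ∀ {n m} {u v w : Elem n m} {j k} → Walk u v j → Walk v w k → Walk u w (j + k)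
Walk-++ here       q = q
Walk-++ (step e p) q = step e (Walk-++ p q)

Walk-reverse : ∀ {n m} {u v : Elem n m} {k} → Walk u v k → Walk v u k
Walk-reverse here = here
Walk-reverse {u = u} (step {k = k} e p) =
  subst (Walk _ u) (+-comm k 1) (Walk-++ (Walk-reverse p) (step (HasseEdge-sym e) here))

⊴⇒Walk : ∀ {n m} {u v : Elem n m} → u ⊴ v → Walk u v (dist u v)
⊴⇒Walk u⊴v = walkUp _ u⊴v refl
  where
  walkUp : ∀ {n m} k {u v : Elem n m} → u ⊴ v → dist u v ≡ k → Walk u v k
  walkUp zero {u} u⊴v d≡0 = subst (λ v → Walk u v 0) (dist≡0⇒≡ d≡0) here
  walkUp (suc k) {u} {v} u⊴v d≡1+k with ∃-unitStep u⊴v (λ d≡0 → 0≢1+n (trans (sym d≡0) d≡1+k))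
  ... | w , u⊴w , w⊴v , d[u,w]≡1 =
    step (inj₁ (dist≡1⇒⋖ u⊴w d[u,w]≡1)) (walkUp k w⊴v (suc-injective 1+d[w,v]≡1+k))
    where
    1+d[w,v]≡1+k : 1 + dist w v ≡ suc k
    1+d[w,v]≡1+k = begin
      1 + dist w v             ≡⟨ cong (_+ dist w v) d[u,w]≡1 ⟨
      dist u w + dist w v      ≡⟨ prefDist-additive (bits u) (bits w) (bits v) u⊴w w⊴v ⟨
      dist u v                 ≡⟨ d≡1+k ⟩
      suc k                    ∎
      where open ≡-Reasoning

⊓-step : ∀ a b (x y : Fin 2) → ∃ λ (z : Fin 2) → a ⊓ b + toℕ z ≡ (a + toℕ x) ⊓ (b + toℕ y)
⊓-step a b 0F 0F = 0F , +-distribʳ-⊓ 0 a b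
⊓-step a b 1F 1F = 1F , +-distribʳ-⊓ 1 a b
⊓-step a b 1F 0F with b ≤? a
... | yes b≤a = 0F , trans (cong (_+ 0) (m≥n⇒m⊓n≡n b≤a)) (sym (m≥n⇒m⊓n≡n (+-mono-≤ b≤a z≤n)))
... | no  b≰a = 1F , trans (cong (_+ 1) (m≤n⇒m⊓n≡m (<⇒≤ a<b))) (sym (m≤n⇒m⊓n≡m a+1≤b+0))
  where
  a<b : a < b
  a<b = ≰⇒> b≰a
  a+1≤b+0 : a + 1 ≤ b + 0
  a+1≤b+0 = subst₂ _≤_ (+-comm 1 a) (sym (+-identityʳ b)) a<b
⊓-step a b 0F 1F with ⊓-step b a 1F 0F
... | z , eq = z , trans (cong (_+ toℕ z) (⊓-comm a b)) (trans eq (⊓-comm (b + 1) (a + 0)))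

minPrefix : ∀ {m} c a b (xs ys : Vec (Fin 2) m) → c ≡ a ⊓ b →
            ∃ λ zs → PrefLe c a zs xs × PrefLe c b zs ys ×
                     prefDist c a zs xs + prefDist c b zs ys ≡ prefDist a b xs ys
minPrefix _ a b []       []       refl = [] , m⊓n≤m a b , m⊓n≤n a b , ∣m⊓n-m∣+∣m⊓n-n∣≡∣m-n∣ a b
minPrefix _ a b (x ∷ xs) (y ∷ ys) refl with ⊓-step a b x y
... | z , eq with minPrefix _ (a + toℕ x) (b + toℕ y) xs ys eq
...   | zs , p , q , d =
  z ∷ zs , (m⊓n≤m a b , p) , (m⊓n≤n a b , q) ,
  trans (interchange ∣ a ⊓ b - a ∣ _ ∣ a ⊓ b - b ∣ _) (cong₂ _+_ (∣m⊓n-m∣+∣m⊓n-n∣≡∣m-n∣ a b) d)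

∃-geodesicLowerBound : ∀ {n m} (u v : Elem n m) →
                       ∃ λ w → w ⊴ u × w ⊴ v × dist w u + dist w v ≡ dist u v
∃-geodesicLowerBound ⟨ g , xs ⟩ ⟨ h , ys ⟩ =
  let g⊓h<n = m<n⇒m⊓o<n (toℕ h) (toℕ<n g)
      f = fromℕ< g⊓h<n
      zs , p , q , d = minPrefix (toℕ f) (toℕ g) (toℕ h) xs ys (toℕ-fromℕ< g⊓h<n)
  in ⟨ f , zs ⟩ , p , q , d

prefDist≤ : ∀ {m} a b (xs ys : Vec (Fin 2) m) → prefDist a b xs ys ≤ ∣ a - b ∣ * suc m + suc m C 2
prefDist≤ a b []       []       = ≤-reflexive (sym (trans (+-identityʳ _) (*-identityʳ _)))
prefDist≤ {suc m} a b (x ∷ xs) (y ∷ ys) = begin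
  ∣ a - b ∣ + prefDist (a + toℕ x) (b + toℕ y) xs ys
    ≤⟨ +-monoʳ-≤ ∣ a - b ∣ (prefDist≤ _ _ xs ys) ⟩
  ∣ a - b ∣ + (∣ a + toℕ x - b + toℕ y ∣ * suc m + suc m C 2)
    ≤⟨ +-monoʳ-≤ ∣ a - b ∣ (+-monoˡ-≤ (suc m C 2) (*-monoˡ-≤ (suc m) ∣a+x-b+y∣≤1+∣a-b∣)) ⟩
  ∣ a - b ∣ + ((∣ a - b ∣ + 1) * suc m + suc m C 2)
    ≡⟨ regroup ∣ a - b ∣ m (suc m C 2) ⟩
  ∣ a - b ∣ * suc (suc m) + (suc m + suc m C 2)
    ≡⟨ cong (∣ a - b ∣ * suc (suc m) +_) ([1+n]C2≡n+nC2 (suc m)) ⟨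
  ∣ a - b ∣ * suc (suc m) + suc (suc m) C 2 ∎
  where
  open ≤-Reasoning
  ∣a+x-b+y∣≤1+∣a-b∣ : ∣ a + toℕ x - b + toℕ y ∣ ≤ ∣ a - b ∣ + 1
  ∣a+x-b+y∣≤1+∣a-b∣ =
    ≤-trans (∣m+o-n+p∣≤∣m-n∣+∣o-p∣ a b (toℕ x) (toℕ y)) (+-monoʳ-≤ ∣ a - b ∣ (∣bit-bit∣≤1 x y))
  regroup : ∀ e m c → e + ((e + 1) * suc m + c) ≡ e * suc (suc m) + (suc m + c)
  regroup = solve-∀

prefDist≤-crossing : ∀ {m} a b (xs ys : Vec (Fin 2) m) → a < b → ¬ PrefLe a b xs ys →
                     prefDist a b xs ys ≤ 1 + m C 2
prefDist≤-crossing a b []       []       a<b ¬p = ⊥-elim (¬p (<⇒≤ a<b))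
prefDist≤-crossing {suc l} a b (x ∷ xs) (y ∷ ys) a<b ¬p with <-cmp (a + toℕ x) (b + toℕ y)
... | tri< a+x<b+y _ _ = begin
  ∣ a - b ∣ + prefDist (a + toℕ x) (b + toℕ y) xs ys
    ≤⟨ +-mono-≤ (m≤n≤m+o⇒∣m-n∣≤o (<⇒≤ a<b) b≤a+l)
                (prefDist≤-crossing _ _ xs ys a+x<b+y (¬p ∘ (<⇒≤ a<b ,_))) ⟩
  l + (1 + l C 2)  ≡⟨ +-suc l (l C 2) ⟩
  1 + (l + l C 2)  ≡⟨ cong suc ([1+n]C2≡n+nC2 l) ⟨
  1 + suc l C 2    ∎
  where
  open ≤-Reasoning
  b≤a+l : b ≤ a + l
  b≤a+l = s≤s⁻¹ (subst (suc b ≤_) (+-suc a l) (¬PrefLe⇒<+length (x ∷ xs) (y ∷ ys) ¬p))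
... | tri≈ _ a+x≡b+y _ = +-mono-≤ (m≤n≤m+o⇒∣m-n∣≤o (<⇒≤ a<b) b≤a+1) tailBound
  where
  b≤a+1 : b ≤ a + 1
  b≤a+1 = ≤-trans (m≤m+n b (toℕ y)) (≤-trans (≤-reflexive (sym a+x≡b+y)) (+-monoʳ-≤ a (toℕ≤1 x)))
  tailBound : prefDist (a + toℕ x) (b + toℕ y) xs ys ≤ suc l C 2
  tailBound = subst (λ e → prefDist (a + toℕ x) (b + toℕ y) xs ys ≤ e * suc l + suc l C 2)
                    (m≡n⇒∣m-n∣≡0 a+x≡b+y) (prefDist≤ (a + toℕ x) (b + toℕ y) xs ys)
... | tri> _ _ b+y<a+x = ⊥-elim (<⇒≱ b+y<a+x a+x≤b+y)
  where
  a+x≤b+y : a + toℕ x ≤ b + toℕ y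
  a+x≤b+y = ≤-trans (+-monoʳ-≤ a (toℕ≤1 x))
              (≤-trans (≤-reflexive (+-comm a 1)) (≤-trans a<b (m≤m+n b (toℕ y))))

incomparable⇒prefDist≤ : ∀ {m} a b (xs ys : Vec (Fin 2) m) → ¬ PrefLe a b xs ys → ¬ PrefLe b a ys xs →
                         prefDist a b xs ys ≤ 1 + m C 2
incomparable⇒prefDist≤ a b [] [] ¬p ¬q with ≤-total a b
... | inj₁ a≤b = ⊥-elim (¬p a≤b)
... | inj₂ b≤a = ⊥-elim (¬q b≤a)
incomparable⇒prefDist≤ {suc l} a b (x ∷ xs) (y ∷ ys) ¬p ¬q with <-cmp a b
... | tri< a<b _ _ = prefDist≤-crossing a b (x ∷ xs) (y ∷ ys) a<b ¬p
... | tri> _ _ b<a =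
  subst (_≤ 1 + suc l C 2) (prefDist-sym b a (y ∷ ys) (x ∷ xs)) (prefDist≤-crossing b a (y ∷ ys) (x ∷ xs) b<a ¬q)
... | tri≈ _ a≡b _ = begin
  ∣ a - b ∣ + prefDist (a + toℕ x) (b + toℕ y) xs ys
    ≡⟨ cong (_+ prefDist (a + toℕ x) (b + toℕ y) xs ys) (m≡n⇒∣m-n∣≡0 a≡b) ⟩
  prefDist (a + toℕ x) (b + toℕ y) xs ys
    ≤⟨ incomparable⇒prefDist≤ _ _ xs ys (¬p ∘ (≤-reflexive a≡b ,_)) (¬q ∘ (≤-reflexive (sym a≡b) ,_)) ⟩
  1 + l C 2        ≤⟨ s≤s (m≤n+m (l C 2) l) ⟩
  1 + (l + l C 2)  ≡⟨ cong suc ([1+n]C2≡n+nC2 l) ⟨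
  1 + suc l C 2    ∎
  where open ≤-Reasoning

lemma5p6 : (m n : ℕ) → 2 ≤ m → m ≤ n → (u v : Elem n m) →
    Incomparable u v → DistLe u v (1 + m C 2)
lemma5p6 m n _ _ u v (u⋬v , v⋬u) =
  let w , w⊴u , w⊴v , geodesic = ∃-geodesicLowerBound u v
  in dist w u + dist w v ,
     subst (_≤ 1 + m C 2) (sym geodesic) (incomparable⇒prefDist≤ _ _ (bits u) (bits v) u⋬v v⋬u) ,
     Walk-++ (Walk-reverse (⊴⇒Walk w⊴u)) (⊴⇒Walk w⊴v)
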